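{- For every integer $n \ge 5$, $\mathrm{eqdim}(S''_n) \ge 2n$.
   Context: All graphs are finite, simple, connected and undirected; $d(u,v)$ denotes the number of edges of a shortest path between $u$ and $v$. A vertex $x$ is equidistant from $u$ and $v$ if $d(u,x)=d(v,x)$. A set $S\subseteq V(G)$ is a distance-equalizer set of $G$ if for every pair of distinct vertices $u,v\in V(G)\setminus S$ there is $x\in S$ equidistant from $u$ and $v$. The equidistant dimension $\mathrm{eqdim}(G)$ is the minimum cardinality of a distance-equalizer set of $G$. The graph $S''_n$ has vertex set $\{a_i,b_i,c_i,d_i : i=0,\dots,n-1\}$ and edge set $\{a_ia_{i+1}, b_ib_{i+1}, c_ic_{i+1}, d_id_{i+1}, a_ib_i, b_ic_i, c_id_i, b_{i+1}c_i : i=0,\dots,n-1\}$, with indices taken modulo $n$. -}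

module Defs where

open import Data.Nat using (ℕ; _<_)
open import Data.Fin using (Fin; toℕ; zero; suc)
open import Data.Nat using () renaming (zero to zeroℕ; suc to sucℕ)
open import Data.Product using (Σ; _×_; _,_)
open import Data.Sum using (_⊎_)
open import Data.List using (List)
open import Data.List.Membership.Propositional using (_∈_; _∉_)
open import Relation.Binary.PropositionalEquality using (_≡_; _≢_)
open import Relation.Nullary using (¬_)
open import Level using (0ℓ)

module Graph {V : Set} (Adj : V → V → Set) where

  data Walk : V → V → ℕ → Set where
    nil  : ∀ {u} → Walk u u zeroℕ
    cons : ∀ {u w v k} → Adj u w → Walk w v k → Walk u v (sucℕ k)

  Dist : V → V → ℕ → Set
  Dist u v k = Walk u v k × (∀ m → m < k → ¬ Walk u v m)

  Equidistant : V → V → V → Set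
  Equidistant x u v = Σ ℕ λ k → Dist u x k × Dist v x k

  IsDistanceEqualizer : List V → Set
  IsDistanceEqualizer S =
    ∀ u v → u ≢ v → u ∉ S → v ∉ S → Σ V λ x → x ∈ S × Equidistant x u v

-- The graph S''_n.  Vertices are pairs (r , i) with r : Fin 4
-- (r = 0,1,2,3 standing for a,b,c,d) and i : Fin n.

Next : ∀ {n} → Fin n → Fin n → Set
Next {n} i j = (sucℕ (toℕ i) ≡ toℕ j) ⊎ (sucℕ (toℕ i) ≡ n × toℕ j ≡ 0)

V'' : ℕ → Set
V'' n = Fin 4 × Fin n

A B C D : Fin 4
A = zero
B = suc zero
C = suc (suc zero)
D = suc (suc (suc zero))

data Edge'' (n : ℕ) : V'' n → V'' n → Set where
  cyc   : ∀ r i j → Next i j → Edge'' n (r , i) (r , j)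
  ab    : ∀ i → Edge'' n (A , i) (B , i)
  bc    : ∀ i → Edge'' n (B , i) (C , i)
  cd    : ∀ i → Edge'' n (C , i)
                         (D , i)
  cross : ∀ i j → Next i j → Edge'' n (B , j)
                                       (C , i)

Adj'' : (n : ℕ) → V'' n → V'' n → Set
Adj'' n u v = Edge'' n u v ⊎ Edge'' n v u

{-# OPTIONS --safe #-}
-- No vertex x is equidistant from a_i and b_i.  Both the projection onto
-- row a and the map a_j ↦ b_j send edges to edges or loops and collapse
-- every edge between row a and the rest, so whichever side of that cut x
-- lies on, it is strictly closer to the endpoint on its own side.  The same
-- holds for c_i and d_i, so a distance-equalizer set meets each of the 2n
-- disjoint pairs {a_i, b_i}, {c_i, d_i}.
module Submission where

open import Defs
open import Data.Bool using (Bool)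
import Data.Bool as Bool
open import Data.Empty using (⊥-elim)
open import Data.Fin using (Fin; zero; suc; combine)
import Data.Fin as Fin
open import Data.Fin.Properties using (injective⇒≤; combine-surjective)
open import Data.List using (List; length; lookup)
open import Data.List.Membership.Propositional using (_∈_)
import Data.List.Membership.DecPropositional as DecMembership
open import Data.List.Relation.Unary.Any using (index)
open import Data.List.Relation.Unary.Any.Properties using (lookup-index)
open import Data.List.Relation.Unary.Unique.Propositional using (Unique)
open import Data.Nat using (ℕ; suc; _≤_; _<_; _*_; z≤n; s≤s)
open import Data.Nat.Properties using (≤-refl; ≤-trans; n≤1+n)
open import Data.Product using (∃-syntax; _×_; _,_; proj₁; proj₂)
open import Data.Product.Properties using (≡-dec)
open import Data.Sum using (_⊎_; inj₁; inj₂; [_,_]; swap)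
open import Function using (const)
open import Relation.Binary.Definitions using (DecidableEquality)
open import Relation.Binary.PropositionalEquality
  using (_≡_; _≢_; refl; sym; trans; cong; subst; subst₂)
open import Relation.Nullary using (¬_; yes; no; ⌊_⌋)

NonExpansive : {V : Set} → (V → V → Set) → (V → V) → Set
NonExpansive Adj f = ∀ {x y} → Adj x y → Adj (f x) (f y) ⊎ f x ≡ f y

CollapsesCut : {V : Set} → (V → V → Set) → (V → V) → (V → Bool) → Set
CollapsesCut Adj f P = ∀ {x y} → Adj x y → P x ≢ P y → f x ≡ f y

Undirected : {V : Set} → (V → V → Set) → V → V → Set
Undirected E u v = E u v ⊎ E v u

module _ {V : Set} (E : V → V → Set) (f : V → V) where

  undirected-nonExpansive :
    (∀ {x y} → E x y → Undirected E (f x) (f y) ⊎ f x ≡ f y) →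
    NonExpansive (Undirected E) f
  undirected-nonExpansive h (inj₁ e) = h e
  undirected-nonExpansive h (inj₂ e) with h e
  ... | inj₁ e′    = inj₁ (swap e′)
  ... | inj₂ fy≡fx = inj₂ (sym fy≡fx)

  undirected-collapsesCut : ∀ {P} → CollapsesCut E f P → CollapsesCut (Undirected E) f P
  undirected-collapsesCut h (inj₁ e) Px≢Py = h e Px≢Py
  undirected-collapsesCut h (inj₂ e) Px≢Py = sym (h e (λ Py≡Px → Px≢Py (sym Py≡Px)))

module NonExpansiveMaps {V : Set} (Adj : V → V → Set) where
  open Graph Adj

  private
    cons-or-stay : ∀ {x y z m} → Adj x y ⊎ x ≡ y → Walk y z m →
                   ∃[ m′ ] m′ ≤ suc m × Walk x z m′
    cons-or-stay (inj₁ e)   w = _ , ≤-refl , cons e w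
    cons-or-stay {z = z} {m} (inj₂ x≡y) w = m , n≤1+n m , subst (λ s → Walk s z m) (sym x≡y) w

  map-walk : ∀ {f u v k} → NonExpansive Adj f → Walk u v k →
             ∃[ m ] m ≤ k × Walk (f u) (f v) m
  map-walk ne nil = 0 , z≤n , nil
  map-walk ne (cons e w) with map-walk ne w
  ... | m , m≤k , fw with cons-or-stay (ne e) fw
  ...   | m′ , m′≤1+m , fw′ = m′ , ≤-trans m′≤1+m (s≤s m≤k) , fw′

  map-walk-across : ∀ {f P u v k} → NonExpansive Adj f → CollapsesCut Adj f P →
                    P u ≢ P v → Walk u v k → ∃[ m ] m < k × Walk (f u) (f v) m
  map-walk-across ne cut Pu≢Pv nil = ⊥-elim (Pu≢Pv refl)
  map-walk-across {f} {P} {u} {v} ne cut Pu≢Pv (cons {w = w} e rest) with P u Bool.≟ P w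
  ... | no Pu≢Pw with map-walk ne rest
  ...   | m , m≤k , fw = m , s≤s m≤k , subst (λ s → Walk s (f v) m) (sym (cut e Pu≢Pw)) fw
  map-walk-across ne cut Pu≢Pv (cons e rest) | yes Pu≡Pw
    with map-walk-across ne cut (λ Pw≡Pv → Pu≢Pv (trans Pu≡Pw Pw≡Pv)) rest
  ... | m , m<k , fw with cons-or-stay (ne e) fw
  ...   | m′ , m′≤1+m , fw′ = m′ , s≤s (≤-trans m′≤1+m m<k) , fw′

  equidistant-sym : ∀ {x u v} → Equidistant x u v → Equidistant x v u
  equidistant-sym (k , du , dv) = k , dv , du

  -- A shortest path from v to x crosses the cut, so its image is a walk
  -- from u to x shorter than d(v, x).
  retraction-separates : ∀ {f P u v x} → NonExpansive Adj f → CollapsesCut Adj f P →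
                         f v ≡ u → f x ≡ x → P v ≢ P x → ¬ Equidistant x u v
  retraction-separates ne cut fv≡u fx≡x Pv≢Px (k , (_ , minimal) , (walk , _))
    with map-walk-across ne cut Pv≢Px walk
  ... | m , m<k , fw = minimal m m<k (subst₂ (λ s t → Walk s t m) fv≡u fx≡x fw)

  equalizer-meets-pair : DecidableEquality V → ∀ {S u v} → IsDistanceEqualizer S →
                         u ≢ v → (∀ x → ¬ Equidistant x u v) → u ∈ S ⊎ v ∈ S
  equalizer-meets-pair _≟_ {S} {u} {v} equalizer u≢v separated with u ∈? S | v ∈? S
    where open DecMembership _≟_ using (_∈?_)
  ... | yes u∈S | _       = inj₁ u∈S
  ... | no _    | yes v∈S = inj₂ v∈S
  ... | no u∉S  | no v∉S  with equalizer u v u≢v u∉S v∉S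
  ...   | x , _ , equidistant = ⊥-elim (separated x equidistant)

classes≤length : ∀ {A : Set} {m} (cls : A → Fin m) (S : List A) →
                 (∀ t → ∃[ x ] x ∈ S × cls x ≡ t) → m ≤ length S
classes≤length {m = m} cls S hit = injective⇒≤ {f = position} position-injective
  where
  position : Fin m → Fin (length S)
  position t = index (proj₁ (proj₂ (hit t)))

  cls-at-position : ∀ t → cls (lookup S (position t)) ≡ t
  cls-at-position t with hit t
  ... | _ , x∈S , cls-x≡t = trans (cong cls (sym (lookup-index x∈S))) cls-x≡t

  position-injective : ∀ {s t} → position s ≡ position t → s ≡ t
  position-injective {s} {t} eq =
    trans (sym (cls-at-position s)) (trans (cong (λ p → cls (lookup S p)) eq) (cls-at-position t))

module _ (n : ℕ) where
  open Graph (Adj'' n)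
  open NonExpansiveMaps (Adj'' n)

  mapRow : (Fin 4 → Fin 4) → V'' n → V'' n
  mapRow g (r , i) = g r , i

  inRow : Fin 4 → V'' n → Bool
  inRow r (s , _) = ⌊ r Fin.≟ s ⌋

  aToB dToC : Fin 4 → Fin 4
  aToB zero = B
  aToB r    = r
  dToC (suc (suc (suc zero))) = C
  dToC r                      = r

  projectRow-nonExpansive : ∀ r → NonExpansive (Adj'' n) (mapRow (const r))
  projectRow-nonExpansive r = undirected-nonExpansive (Edge'' n) _ λ where
    (cyc _ i j next) → inj₁ (inj₁ (cyc r i j next))
    (ab i)           → inj₂ refl
    (bc i)           → inj₂ refl
    (cd i)           → inj₂ refl
    (cross i j next) → inj₁ (inj₂ (cyc r i j next))

  projectRow-collapsesCut : ∀ r s → ⌊ s Fin.≟ B ⌋ ≡ ⌊ s Fin.≟ C ⌋ →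
                            CollapsesCut (Adj'' n) (mapRow (const r)) (inRow s)
  projectRow-collapsesCut r s b∼c = undirected-collapsesCut (Edge'' n) _ λ where
    (cyc _ _ _ _) different → ⊥-elim (different refl)
    (ab _)        _         → refl
    (bc _)        _         → refl
    (cd _)        _         → refl
    (cross _ _ _) different → ⊥-elim (different b∼c)

  aToB-nonExpansive : NonExpansive (Adj'' n) (mapRow aToB)
  aToB-nonExpansive = undirected-nonExpansive (Edge'' n) _ λ where
    (cyc r i j next) → inj₁ (inj₁ (cyc (aToB r) i j next))
    (ab i)           → inj₂ refl
    (bc i)           → inj₁ (inj₁ (bc i))
    (cd i)           → inj₁ (inj₁ (cd i))
    (cross i j next) → inj₁ (inj₁ (cross i j next))

  aToB-collapsesCut : CollapsesCut (Adj'' n) (mapRow aToB) (inRow A)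
  aToB-collapsesCut = undirected-collapsesCut (Edge'' n) _ λ where
    (cyc _ _ _ _) different → ⊥-elim (different refl)
    (ab _)        _         → refl
    (bc _)        different → ⊥-elim (different refl)
    (cd _)        different → ⊥-elim (different refl)
    (cross _ _ _) different → ⊥-elim (different refl)

  dToC-nonExpansive : NonExpansive (Adj'' n) (mapRow dToC)
  dToC-nonExpansive = undirected-nonExpansive (Edge'' n) _ λ where
    (cyc r i j next) → inj₁ (inj₁ (cyc (dToC r) i j next))
    (ab i)           → inj₁ (inj₁ (ab i))
    (bc i)           → inj₁ (inj₁ (bc i))
    (cd i)           → inj₂ refl
    (cross i j next) → inj₁ (inj₁ (cross i j next))

  dToC-collapsesCut : CollapsesCut (Adj'' n) (mapRow dToC) (inRow D)
  dToC-collapsesCut = undirected-collapsesCut (Edge'' n) _ λ where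
    (cyc _ _ _ _) different → ⊥-elim (different refl)
    (ab _)        different → ⊥-elim (different refl)
    (bc _)        different → ⊥-elim (different refl)
    (cd _)        _         → refl
    (cross _ _ _) different → ⊥-elim (different refl)

  ab-not-equalized : ∀ i x → ¬ Equidistant x (A , i) (B , i)
  ab-not-equalized i (zero , _) =
    retraction-separates (projectRow-nonExpansive A) (projectRow-collapsesCut A A refl)
      refl refl (λ ())
  ab-not-equalized i (suc _ , _) equidistant =
    retraction-separates aToB-nonExpansive aToB-collapsesCut refl refl (λ ())
      (equidistant-sym equidistant)

  cd-not-equalized : ∀ i x → ¬ Equidistant x (C , i) (D , i)
  cd-not-equalized i (suc (suc (suc zero)) , _) equidistant =
    retraction-separates (projectRow-nonExpansive D) (projectRow-collapsesCut D D refl)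
      refl refl (λ ()) (equidistant-sym equidistant)
  cd-not-equalized i (zero , _) =
    retraction-separates dToC-nonExpansive dToC-collapsesCut refl refl (λ ())
  cd-not-equalized i (suc zero , _) =
    retraction-separates dToC-nonExpansive dToC-collapsesCut refl refl (λ ())
  cd-not-equalized i (suc (suc zero) , _) =
    retraction-separates dToC-nonExpansive dToC-collapsesCut refl refl (λ ())

  _≟ᵥ_ : DecidableEquality (V'' n)
  _≟ᵥ_ = ≡-dec Fin._≟_ Fin._≟_

  rung : Fin 4 → Fin 2
  rung zero       = zero
  rung (suc zero) = zero
  rung _          = suc zero

  rungIndex : V'' n → Fin (2 * n)
  rungIndex (r , i) = combine (rung r) i

  equalizer-meets-every-rung : ∀ {S} → IsDistanceEqualizer S →
                               ∀ t → ∃[ x ] x ∈ S × rungIndex x ≡ t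
  equalizer-meets-every-rung equalizer t with combine-surjective {2} {n} t
  ... | zero , i , refl =
    [ (λ a∈S → _ , a∈S , refl) , (λ b∈S → _ , b∈S , refl) ]
      (equalizer-meets-pair _≟ᵥ_ equalizer (λ ()) (ab-not-equalized i))
  ... | suc zero , i , refl =
    [ (λ c∈S → _ , c∈S , refl) , (λ d∈S → _ , d∈S , refl) ]
      (equalizer-meets-pair _≟ᵥ_ equalizer (λ ()) (cd-not-equalized i))

mainTheorem4 : ∀ (n : ℕ) → 5 ≤ n → (S : List (V'' n)) → Unique S →
                 Graph.IsDistanceEqualizer (Adj'' n) S → 2 * n ≤ length S
mainTheorem4 n _ S _ equalizer =
  classes≤length (rungIndex n) S (equalizer-meets-every-rung n equalizer)
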